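{- Let $\mathcal{G}$ be a connected groupoid (so $v\mathcal{G}w\neq\emptyset$ for all units $v,w$). Let $S\subset\mathcal{G}\times\mathcal{G}$ satisfy $s(\alpha)=s(\beta)$ and $r(\alpha)=r(\beta)$ for all $(\alpha,\beta)\in S$. Let $R$ be the congruence relation on $\mathcal{G}$ generated by $S$, let $\mathcal{H}=\mathcal{G}/R$ be the quotient groupoid and $Q:\mathcal{G}\to\mathcal{H}$ the quotient map. Fix $u\in\mathcal{G}^0$, and for each $v\in\mathcal{G}^0$ choose $\kappa_v\in v\mathcal{G}u$ with $\kappa_u=u$. Let $K$ be the normal subgroup of $\mathcal{G}(u)$ generated by \[ \{\kappa_{r(\alpha)}^{ -1}\alpha\beta^{ -1}\kappa_{r(\alpha)}:(\alpha,\beta)\in S\}. \] Then $\mathcal{H}(u)=\mathcal{G}(u)/K$.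
   Context: A congruence relation on a small category $\mathcal{C}$ is an equivalence relation $R$ on $\mathcal{C}$ such that (i) if $(\alpha,\beta)\in R$ then $s(\alpha)=s(\beta)$ and $r(\alpha)=r(\beta)$, and (ii) if $(\alpha,\beta),(\lambda,\mu)\in R$ and $s(\alpha)=r(\lambda)$ then $(\alpha\lambda,\beta\mu)\in R$. Then $\mathcal{C}/R$ is a category and the quotient map is a functor. The congruence generated by a set $S$ satisfying (i) is the smallest congruence relation containing $S$. For a unit $u$ of a groupoid $\mathcal{G}$, $\mathcal{G}(u)=u\mathcal{G}u$ is the isotropy group at $u$. -}

module Defs where

open import Level using (Level; _⊔_; suc)
open import Relation.Binary.PropositionalEquality using (_≡_)

-- Hom v w is the set v𝒢w of arrows with range v and
-- source w; composition αλ is defined when s(α) = r(λ).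
record Groupoid (o h : Level) : Set (suc (o ⊔ h)) where
  infixl 7 _·_
  field
    Ob    : Set o
    Hom   : Ob → Ob → Set h
    _·_   : ∀ {x y z} → Hom x y → Hom y z → Hom x z
    idn   : (x : Ob) → Hom x x
    _⁻¹   : ∀ {x y} → Hom x y → Hom y x
    assoc : ∀ {w x y z} (a : Hom w x) (b : Hom x y) (c : Hom y z) →
            (a · b) · c ≡ a · (b · c)
    idˡ   : ∀ {x y} (a : Hom x y) → idn x · a ≡ a
    idʳ   : ∀ {x y} (a : Hom x y) → a · idn y ≡ a
    invˡ  : ∀ {x y} (a : Hom x y) → (a ⁻¹) · a ≡ idn y
    invʳ  : ∀ {x y} (a : Hom x y) → a · (a ⁻¹) ≡ idn x

module _ {o h : Level} (G : Groupoid o h) where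
  open Groupoid G

  Connected : Set (o ⊔ h)
  Connected = (v w : Ob) → Hom v w

  -- A set S ⊆ 𝒢 × 𝒢 with s(α)=s(β), r(α)=r(β) for (α,β) ∈ S is a family
  -- of relations on each hom-set.
  PairSet : (ℓ : Level) → Set (o ⊔ h ⊔ suc ℓ)
  PairSet ℓ = ∀ {v w} → Hom v w → Hom v w → Set ℓ

  data CongGen {ℓ} (S : PairSet ℓ) : ∀ {v w} → Hom v w → Hom v w → Set (o ⊔ h ⊔ ℓ) where
    base  : ∀ {v w} {a b : Hom v w} → S a b → CongGen S a b
    crefl : ∀ {v w} (a : Hom v w) → CongGen S a a
    csym  : ∀ {v w} {a b : Hom v w} → CongGen S a b → CongGen S b a
    ctrans : ∀ {v w} {a b c : Hom v w} → CongGen S a b → CongGen S b c → CongGen S a c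
    ccomp : ∀ {x y z} {a b : Hom x y} {l m : Hom y z} →
            CongGen S a b → CongGen S l m → CongGen S (a · l) (b · m)

  data NormalClosure {ℓ} (u : Ob) (X : Hom u u → Set ℓ) : Hom u u → Set (h ⊔ ℓ) where
    gen  : ∀ {g} → X g → NormalClosure u X g
    one  : NormalClosure u X (idn u)
    inv  : ∀ {g} → NormalClosure u X g → NormalClosure u X (g ⁻¹)
    mul  : ∀ {g k} → NormalClosure u X g → NormalClosure u X k → NormalClosure u X (g · k)
    conj : ∀ (c : Hom u u) {g} → NormalClosure u X g → NormalClosure u X (c · g · (c ⁻¹))

module Submission where

-- Proof idea.  Write δ(a,b) = a·b⁻¹ for parallel arrows a, b ∈ v𝒢w, and let
-- κ_v^* g = κ_v⁻¹·g·κ_v be the transport of a loop g at v to a loop at u.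
--
--  (⇒) By induction on a derivation of a ∼ b in the generated congruence,
--      κ_v^*(δ(a,b)) ∈ K: generators give generators of K, reflexivity gives 1,
--      symmetry gives inverses, transitivity gives products (δ(a,b)δ(b,c) = δ(a,c)),
--      and composition gives δ(al,bm) = δ(a,b)·(b δ(l,m) b⁻¹), whose transport
--      is a product of an element of K and a conjugate of one.
--  (⇐) The loops at u congruent to 1 form a normal subgroup of 𝒢(u), and every
--      generator κ⁻¹αβ⁻¹κ is congruent to κ⁻¹ββ⁻¹κ = 1; hence K consists of
--      loops congruent to 1.  Finally a·b⁻¹ ∼ 1 implies a = (a·b⁻¹)·b ∼ b.
--
-- Since κ_u = u, transport at u is the identity and the two directions combine.

open import Defs
open import Level using (Level; _⊔_)
open import Data.Product using (Σ; _×_; _,_)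
open import Relation.Binary.PropositionalEquality
  using (_≡_; refl; sym; trans; cong; cong₂; subst; subst₂; module ≡-Reasoning)

module GroupoidAlgebra {o h : Level} (G : Groupoid o h) where
  open Groupoid G
  open ≡-Reasoning

  inverse-unique : ∀ {x y} (a : Hom x y) (b : Hom y x) → a · b ≡ idn x → b ≡ a ⁻¹
  inverse-unique a b ab≡1 = begin
    b                ≡⟨ sym (idˡ b) ⟩
    idn _ · b        ≡⟨ cong (_· b) (sym (invˡ a)) ⟩
    (a ⁻¹ · a) · b   ≡⟨ assoc _ _ _ ⟩
    a ⁻¹ · (a · b)   ≡⟨ cong (a ⁻¹ ·_) ab≡1 ⟩
    a ⁻¹ · idn _     ≡⟨ idʳ _ ⟩
    a ⁻¹             ∎

  ⁻¹-involutive : ∀ {x y} (a : Hom x y) → (a ⁻¹) ⁻¹ ≡ a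
  ⁻¹-involutive a = sym (inverse-unique (a ⁻¹) a (invˡ a))

  idn-⁻¹ : ∀ x → idn x ⁻¹ ≡ idn x
  idn-⁻¹ x = sym (inverse-unique (idn x) (idn x) (idˡ _))

  cancel-invʳ : ∀ {w x y z} (a : Hom w x) (x' : Hom x y) (b : Hom x z) →
                (a · x') · (x' ⁻¹ · b) ≡ a · b
  cancel-invʳ a x' b = begin
    (a · x') · (x' ⁻¹ · b)   ≡⟨ assoc _ _ _ ⟩
    a · (x' · (x' ⁻¹ · b))   ≡⟨ cong (a ·_) (sym (assoc _ _ _)) ⟩
    a · ((x' · x' ⁻¹) · b)   ≡⟨ cong (λ t → a · (t · b)) (invʳ x') ⟩
    a · (idn _ · b)          ≡⟨ cong (a ·_) (idˡ b) ⟩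
    a · b                    ∎

  cancel-invˡ : ∀ {w x y z} (a : Hom w x) (x' : Hom y x) (b : Hom x z) →
                (a · x' ⁻¹) · (x' · b) ≡ a · b
  cancel-invˡ a x' b = begin
    (a · x' ⁻¹) · (x' · b)           ≡⟨ cong (λ t → (a · x' ⁻¹) · (t · b)) (sym (⁻¹-involutive x')) ⟩
    (a · x' ⁻¹) · ((x' ⁻¹) ⁻¹ · b)   ≡⟨ cancel-invʳ a (x' ⁻¹) b ⟩
    a · b                            ∎

  ⁻¹-anti : ∀ {x y z} (a : Hom x y) (b : Hom y z) → (a · b) ⁻¹ ≡ b ⁻¹ · a ⁻¹
  ⁻¹-anti a b = sym (inverse-unique (a · b) (b ⁻¹ · a ⁻¹) (begin
    (a · b) · (b ⁻¹ · a ⁻¹)   ≡⟨ cancel-invʳ a b (a ⁻¹) ⟩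
    a · a ⁻¹                  ≡⟨ invʳ a ⟩
    idn _                     ∎))

module Transport {o h : Level} (G : Groupoid o h) where
  open Groupoid G
  open GroupoidAlgebra G
  open ≡-Reasoning

  transport : ∀ {v u} → Hom v u → Hom v v → Hom u u
  transport x p = (x ⁻¹ · p) · x

  transport-idn : ∀ {v u} (x : Hom v u) → transport x (idn v) ≡ idn u
  transport-idn x = trans (cong (_· x) (idʳ _)) (invˡ x)

  transport-mul : ∀ {v u} (x : Hom v u) (p q : Hom v v) →
                  transport x (p · q) ≡ transport x p · transport x q
  transport-mul x p q = begin
    (x ⁻¹ · (p · q)) · x               ≡⟨ cong (_· x) (sym (assoc _ _ _)) ⟩
    ((x ⁻¹ · p) · q) · x               ≡⟨ assoc _ _ _ ⟩
    (x ⁻¹ · p) · (q · x)               ≡⟨ sym (cancel-invʳ (x ⁻¹ · p) x (q · x)) ⟩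
    ((x ⁻¹ · p) · x) · (x ⁻¹ · (q · x)) ≡⟨ cong (((x ⁻¹ · p) · x) ·_) (sym (assoc _ _ _)) ⟩
    ((x ⁻¹ · p) · x) · ((x ⁻¹ · q) · x) ∎

  transport-inv : ∀ {v u} (x : Hom v u) (p : Hom v v) →
                  transport x (p ⁻¹) ≡ transport x p ⁻¹
  transport-inv x p = sym (begin
    ((x ⁻¹ · p) · x) ⁻¹         ≡⟨ ⁻¹-anti _ _ ⟩
    x ⁻¹ · (x ⁻¹ · p) ⁻¹        ≡⟨ cong (x ⁻¹ ·_) (⁻¹-anti _ _) ⟩
    x ⁻¹ · (p ⁻¹ · (x ⁻¹) ⁻¹)   ≡⟨ cong (λ t → x ⁻¹ · (p ⁻¹ · t)) (⁻¹-involutive x) ⟩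
    x ⁻¹ · (p ⁻¹ · x)           ≡⟨ sym (assoc _ _ _) ⟩
    (x ⁻¹ · p ⁻¹) · x           ∎)

  transport-comp : ∀ {w v u} (y : Hom w v) (x : Hom v u) (q : Hom w w) →
                   transport (y · x) q ≡ transport x (transport y q)
  transport-comp y x q = begin
    ((y · x) ⁻¹ · q) · (y · x)       ≡⟨ cong (λ t → (t · q) · (y · x)) (⁻¹-anti y x) ⟩
    ((x ⁻¹ · y ⁻¹) · q) · (y · x)    ≡⟨ sym (assoc _ _ _) ⟩
    (((x ⁻¹ · y ⁻¹) · q) · y) · x    ≡⟨ cong (λ t → (t · y) · x) (assoc _ _ _) ⟩
    ((x ⁻¹ · (y ⁻¹ · q)) · y) · x    ≡⟨ cong (_· x) (assoc _ _ _) ⟩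
    (x ⁻¹ · ((y ⁻¹ · q) · y)) · x    ∎

  transport-along-idn : ∀ {u} (p : Hom u u) → transport (idn u) p ≡ p
  transport-along-idn p = trans (idʳ _) (trans (cong (_· p) (idn-⁻¹ _)) (idˡ p))

  conjugate≡transport : ∀ {u} (c g : Hom u u) → (c · g) · c ⁻¹ ≡ transport (c ⁻¹) g
  conjugate≡transport c g = cong (λ t → (t · g) · c ⁻¹) (sym (⁻¹-involutive c))

module Difference {o h : Level} (G : Groupoid o h) where
  open Groupoid G
  open GroupoidAlgebra G
  open Transport G
  open ≡-Reasoning

  δ : ∀ {v w} → Hom v w → Hom v w → Hom v v
  δ a b = a · b ⁻¹

  δ-self : ∀ {v w} (a : Hom v w) → δ a a ≡ idn v
  δ-self = invʳ

  δ-swap : ∀ {v w} (a b : Hom v w) → δ a b ⁻¹ ≡ δ b a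
  δ-swap a b = trans (⁻¹-anti a (b ⁻¹)) (cong (_· a ⁻¹) (⁻¹-involutive b))

  δ-chain : ∀ {v w} (a b c : Hom v w) → δ a b · δ b c ≡ δ a c
  δ-chain a b c = cancel-invˡ a b (c ⁻¹)

  δ-compose : ∀ {x y z} (a b : Hom x y) (l m : Hom y z) →
              δ (a · l) (b · m) ≡ δ a b · transport (b ⁻¹) (δ l m)
  δ-compose a b l m = begin
    (a · l) · (b · m) ⁻¹                      ≡⟨ cong ((a · l) ·_) (⁻¹-anti b m) ⟩
    (a · l) · (m ⁻¹ · b ⁻¹)                   ≡⟨ assoc _ _ _ ⟩
    a · (l · (m ⁻¹ · b ⁻¹))                   ≡⟨ cong (a ·_) (sym (assoc _ _ _)) ⟩
    a · ((l · m ⁻¹) · b ⁻¹)                   ≡⟨ sym (cancel-invˡ a b _) ⟩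
    (a · b ⁻¹) · (b · ((l · m ⁻¹) · b ⁻¹))    ≡⟨ cong ((a · b ⁻¹) ·_) (sym (assoc _ _ _)) ⟩
    (a · b ⁻¹) · ((b · (l · m ⁻¹)) · b ⁻¹)    ≡⟨ cong (λ t → (a · b ⁻¹) · ((t · (l · m ⁻¹)) · b ⁻¹))
                                                     (sym (⁻¹-involutive b)) ⟩
    (a · b ⁻¹) · transport (b ⁻¹) (l · m ⁻¹)  ∎

  δ-recover : ∀ {v w} (a b : Hom v w) → δ a b · b ≡ a
  δ-recover a b = trans (assoc _ _ _) (trans (cong (a ·_) (invˡ b)) (idʳ a))

module Congruence {o h ℓ : Level} (G : Groupoid o h) (S : PairSet G ℓ) where
  open Groupoid G
  open Difference G

  _∼_ : ∀ {v w} → Hom v w → Hom v w → Set (o ⊔ h ⊔ ℓ)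
  _∼_ = CongGen G S

  trivial-δ⇒congruent : ∀ {v w} (a b : Hom v w) → δ a b ∼ idn v → a ∼ b
  trivial-δ⇒congruent a b δ∼1 =
    subst₂ _∼_ (δ-recover a b) (idˡ b) (ccomp δ∼1 (crefl b))

  normal-closure-trivial : ∀ {ℓ'} {u} {X : Hom u u → Set ℓ'} →
    (∀ {g} → X g → g ∼ idn u) → ∀ {g} → NormalClosure G u X g → g ∼ idn u
  normal-closure-trivial triv (gen x) = triv x
  normal-closure-trivial triv one = crefl _
  normal-closure-trivial triv (inv {g} k) =
    subst₂ _∼_ (idʳ _) (invˡ g) (ccomp (crefl (g ⁻¹)) (csym (normal-closure-trivial triv k)))
  normal-closure-trivial triv (mul k₁ k₂) =
    subst₂ _∼_ refl (idˡ _)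
      (ccomp (normal-closure-trivial triv k₁) (normal-closure-trivial triv k₂))
  normal-closure-trivial triv (conj c k) =
    subst₂ _∼_ refl (trans (cong (_· c ⁻¹) (idʳ c)) (invʳ c))
      (ccomp (ccomp (crefl c) (normal-closure-trivial triv k)) (crefl (c ⁻¹)))

module Presentation {o h ℓ : Level} (G : Groupoid o h) (S : PairSet G ℓ)
  (u : Groupoid.Ob G) (κ : (v : Groupoid.Ob G) → Groupoid.Hom G v u) where
  open Groupoid G
  open GroupoidAlgebra G
  open Transport G
  open Difference G
  open Congruence G S
  open ≡-Reasoning

  Generator : Hom u u → Set (o ⊔ h ⊔ ℓ)
  Generator g = Σ Ob λ w → Σ Ob λ v → Σ (Hom w v) λ a → Σ (Hom w v) λ b →
                S a b × (g ≡ (κ w ⁻¹) · a · (b ⁻¹) · κ w)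

  K : Hom u u → Set (o ⊔ h ⊔ ℓ)
  K = NormalClosure G u Generator

  generator≡transport : ∀ {w v} (a b : Hom w v) →
                        (κ w ⁻¹) · a · (b ⁻¹) · κ w ≡ transport (κ w) (δ a b)
  generator≡transport {w} a b = cong (_· κ w) (assoc _ _ _)

  transport-through : ∀ {x y} (b : Hom x y) (g : Hom y y) →
    transport (κ x) (transport (b ⁻¹) g) ≡ transport ((κ y ⁻¹ · b ⁻¹) · κ x) (transport (κ y) g)
  transport-through {x} {y} b g = begin
    transport (κ x) (transport (b ⁻¹) g)     ≡⟨ sym (transport-comp (b ⁻¹) (κ x) g) ⟩
    transport (b ⁻¹ · κ x) g                 ≡⟨ cong (λ t → transport t g) b⁻¹κx≡κy·d ⟩
    transport (κ y · d) g                    ≡⟨ transport-comp (κ y) d g ⟩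
    transport d (transport (κ y) g)          ∎
    where
    d = (κ y ⁻¹ · b ⁻¹) · κ x
    b⁻¹κx≡κy·d : b ⁻¹ · κ x ≡ κ y · d
    b⁻¹κx≡κy·d = begin
      b ⁻¹ · κ x                      ≡⟨ sym (idˡ _) ⟩
      idn y · (b ⁻¹ · κ x)            ≡⟨ sym (cancel-invʳ (idn y) (κ y) _) ⟩
      (idn y · κ y) · (κ y ⁻¹ · (b ⁻¹ · κ x)) ≡⟨ cong₂ _·_ (idˡ _) (sym (assoc _ _ _)) ⟩
      κ y · d                         ∎

  congruent⇒K : ∀ {v w} {a b : Hom v w} → a ∼ b → K (transport (κ v) (δ a b))
  congruent⇒K (base {a = a} {b} s) = gen (_ , _ , a , b , s , sym (generator≡transport a b))
  congruent⇒K {v} (crefl a) =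
    subst K (sym (trans (cong (transport (κ v)) (δ-self a)) (transport-idn (κ v)))) one
  congruent⇒K {v} {a = a} {b} (csym r) =
    subst K (trans (sym (transport-inv (κ v) _)) (cong (transport (κ v)) (δ-swap b a)))
      (inv (congruent⇒K r))
  congruent⇒K {v} (ctrans {a = a} {b} {c} r₁ r₂) =
    subst K (trans (sym (transport-mul (κ v) _ _)) (cong (transport (κ v)) (δ-chain a b c)))
      (mul (congruent⇒K r₁) (congruent⇒K r₂))
  congruent⇒K (ccomp {x} {y} {a = a} {b} {l} {m} r₁ r₂) =
    subst K (sym transported-δ) (mul (congruent⇒K r₁) conjugate∈K)
    where
    d = (κ y ⁻¹ · b ⁻¹) · κ x
    g = transport (κ y) (δ l m)
    conjugate∈K : K (transport d g)
    conjugate∈K = subst K (trans (conjugate≡transport (d ⁻¹) g)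
                                 (cong (λ t → transport t g) (⁻¹-involutive d)))
                          (conj (d ⁻¹) (congruent⇒K r₂))
    transported-δ : transport (κ x) (δ (a · l) (b · m)) ≡ transport (κ x) (δ a b) · transport d g
    transported-δ = begin
      transport (κ x) (δ (a · l) (b · m))
        ≡⟨ cong (transport (κ x)) (δ-compose a b l m) ⟩
      transport (κ x) (δ a b · transport (b ⁻¹) (δ l m))
        ≡⟨ transport-mul (κ x) _ _ ⟩
      transport (κ x) (δ a b) · transport (κ x) (transport (b ⁻¹) (δ l m))
        ≡⟨ cong (transport (κ x) (δ a b) ·_) (transport-through b (δ l m)) ⟩
      transport (κ x) (δ a b) · transport d g
        ∎

  generator-trivial : ∀ {g} → Generator g → g ∼ idn u
  generator-trivial (w , v , a , b , s , g≡) =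
    subst₂ _∼_ (sym g≡) b-generator≡1
      (ccomp (ccomp (ccomp (crefl (κ w ⁻¹)) (base s)) (crefl (b ⁻¹))) (crefl (κ w)))
    where
    b-generator≡1 : (κ w ⁻¹) · b · (b ⁻¹) · κ w ≡ idn u
    b-generator≡1 = begin
      (κ w ⁻¹) · b · (b ⁻¹) · κ w   ≡⟨ generator≡transport b b ⟩
      transport (κ w) (δ b b)       ≡⟨ cong (transport (κ w)) (δ-self b) ⟩
      transport (κ w) (idn w)       ≡⟨ transport-idn (κ w) ⟩
      idn u                         ∎

  K⇒trivial : ∀ {g} → K g → g ∼ idn u
  K⇒trivial = normal-closure-trivial generator-trivial

-- The congruence restricted to 𝒢(u) is exactly the coset relation of K,
-- i.e. ℋ(u) = 𝒢(u)/K.  (Connectedness is only needed for κ to exist.)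
mainTheorem9 : ∀ {o h ℓ : Level} (G : Groupoid o h) → Connected G →
    (S : PairSet G ℓ) →
    let open Groupoid G in
    (u : Ob) (κ : (v : Ob) → Hom v u) → κ u ≡ idn u →
    let K : Hom u u → Set (o ⊔ h ⊔ ℓ)
        K = NormalClosure G u (λ g → Σ Ob λ w → Σ Ob λ v → Σ (Hom w v) λ a → Σ (Hom w v) λ b →
              S a b × (g ≡ (κ w ⁻¹) · a · (b ⁻¹) · κ w))
    in (a b : Hom u u) →
       ((CongGen G S a b → K (a · (b ⁻¹))) × (K (a · (b ⁻¹)) → CongGen G S a b))
mainTheorem9 G _ S u κ κu≡u a b =
    (λ a∼b → subst K transport-at-u (congruent⇒K a∼b))
  , (λ δ∈K → trivial-δ⇒congruent a b (K⇒trivial δ∈K))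
  where
  open Groupoid G
  open Transport G
  open Congruence G S
  open Presentation G S u κ
  transport-at-u : transport (κ u) (a · b ⁻¹) ≡ a · b ⁻¹
  transport-at-u = trans (cong (λ t → transport t (a · b ⁻¹)) κu≡u) (transport-along-idn _)
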